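{- Let $G$ be a graph and $r$ a positive integer. Then $\mathcal{R}(G)\cong K_r$ if and only if $G$ is a threshold graph in whose construction exactly $r-1$ vertices were added as universal vertices.
   Context: All graphs are finite, simple and undirected; $N(v)$ denotes the open neighbourhood of $v$. A set $S\subseteq V(G)$ is a dominating set if every vertex of $G$ is in $S$ or adjacent to a vertex of $S$; it is a minimal dominating set if no proper subset of $S$ is a dominating set. The reconfiguration graph $\mathcal{R}(G)$ has as vertex set the collection of all minimal dominating sets of $G$, and two minimal dominating sets $M_1,M_2$ are adjacent iff there is a vertex $v$ with either ($M_2\setminus M_1=\{v\}$ and $M_1\setminus M_2\subseteq N(v)$) or ($M_1\setminus M_2=\{v\}$ and $M_2\setminus M_1\subseteq N(v)$). A threshold graph is a graph obtained by starting from $K_1$ and repeatedly adding either an isolated vertex (adjacent to none of the existing vertices) or a universal vertex (adjacent to all existing vertices); the count "$r-1$ vertices added as universal vertices" refers to the number of additions of the second kind in such a construction. -}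

module Defs where

open import Data.Nat using (ℕ; zero; suc)
open import Data.Bool using (Bool; true; false)
open import Data.Fin using (Fin; zero; suc)
open import Data.Fin.Subset using (Subset; _∈_; _∉_; _⊆_; _─_; ⁅_⁆)
open import Data.List using (List; []; _∷_; length)
open import Data.Product using (Σ; ∃; _×_; _,_)
open import Data.Sum using (_⊎_)
open import Relation.Binary.PropositionalEquality using (_≡_; _≢_)
open import Relation.Nullary using (¬_)
open import Function.Bundles using (_⇔_; _⤖_; Bijection)
open import Function.Definitions using (Injective)

Adjacency : ℕ → Set
Adjacency n = Fin n → Fin n → Bool

IsSimpleGraph : {n : ℕ} → Adjacency n → Set
IsSimpleGraph {n} A = (∀ u v → A u v ≡ A v u) × (∀ v → A v v ≡ false)

IsDominating : {n : ℕ} → Adjacency n → Subset n → Set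
IsDominating {n} A S = ∀ (v : Fin n) → v ∈ S ⊎ (∃ λ u → u ∈ S × A u v ≡ true)

IsMinimalDominating : {n : ℕ} → Adjacency n → Subset n → Set
IsMinimalDominating {n} A S =
  IsDominating A S × (∀ (T : Subset n) → T ⊆ S → T ≢ S → ¬ IsDominating A T)

ReconfAdj : {n : ℕ} → Adjacency n → Subset n → Subset n → Set
ReconfAdj {n} A M₁ M₂ = ∃ λ (v : Fin n) →
    ((M₂ ─ M₁) ≡ ⁅ v ⁆ × (∀ u → u ∈ (M₁ ─ M₂) → A u v ≡ true))
  ⊎ ((M₁ ─ M₂) ≡ ⁅ v ⁆ × (∀ u → u ∈ (M₂ ─ M₁) → A u v ≡ true))

-- R(G) ≅ K_r : an explicit bijection g between Fin r (vertices of K_r) and the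
-- set of minimal dominating sets of G, with R-adjacency ⇔ distinctness.
ReconfIsoComplete : {n : ℕ} → Adjacency n → ℕ → Set
ReconfIsoComplete {n} A r = Σ (Fin r → Subset n) λ g →
    (∀ i → IsMinimalDominating A (g i))
  × Injective _≡_ _≡_ g
  × (∀ S → IsMinimalDominating A S → ∃ λ i → g i ≡ S)
  × (∀ i j → ReconfAdj A (g i) (g j) ⇔ (i ≢ j))

-- A construction is a list of steps after the
-- initial K₁; true = add a universal vertex, false = add an isolated vertex.
-- The head of the list is the LAST step; the newly added vertex is 'zero'.
extend : {n : ℕ} → Bool → Adjacency n → Adjacency (suc n)
extend b A zero    zero    = false
extend b A zero    (suc j) = b
extend b A (suc i) zero    = b
extend b A (suc i) (suc j) = A i j

build : (cs : List Bool) → Adjacency (suc (length cs))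
build []       = λ _ _ → false
build (b ∷ cs) = extend b (build cs)

countUniversal : List Bool → ℕ
countUniversal []          = 0
countUniversal (true ∷ cs)  = suc (countUniversal cs)
countUniversal (false ∷ cs) = countUniversal cs

GraphIso : {m n : ℕ} → Adjacency m → Adjacency n → Set
GraphIso {m} {n} A B = Σ (Fin m ⤖ Fin n) λ f →
  ∀ i j → B (Bijection.to f i) (Bijection.to f j) ≡ A i j

IsThresholdWithUniversal : {n : ℕ} → Adjacency n → ℕ → Set
IsThresholdWithUniversal {n} A k = ∃ λ (cs : List Bool) →
  countUniversal cs ≡ k × GraphIso (build cs) A

-- Adding an isolated vertex to G does not change R(G): the new vertex lies in
-- every minimal dominating set. Adding a universal vertex u to a nonempty G
-- adds exactly one minimal dominating set, {u}, and it is R-adjacent to every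
-- other one, so R(G) ≅ K_r becomes K_{r+1}. Conversely, if G has neither an
-- isolated nor a universal vertex, then by Ore's argument the complement of a
-- minimal dominating set D is dominating, hence contains a minimal dominating
-- set M disjoint from D. In a complete R(G) the sets D ≠ M are adjacent, which
-- for disjoint sets forces one of them to be a singleton {v}, and then v is
-- universal. So a complete R(G) always has an isolated or universal vertex to
-- peel off, and induction recovers the threshold construction.
module Submission where

open import Data.Bool using (Bool; true; false)
import Data.Bool.Properties as Bool
open import Data.Empty using (⊥-elim) renaming (⊥ to Empty)
open import Data.Fin using (Fin; zero; suc; punchIn; punchOut)
open import Data.Fin.Permutation
  using (Permutation; _⟨$⟩ʳ_; _⟨$⟩ˡ_; inverseˡ; inverseʳ; flip; _∘ₚ_; lift₀; insert; insert-punchIn)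
  renaming (id to idₚ)
open import Data.Fin.Properties
  using (_≟_; all?; any?; ¬∀⟶∃¬; suc-injective; punchInᵢ≢i; punchIn-injective; punchIn-punchOut)
open import Data.Fin.Subset using (Subset; _∈_; _∉_; _⊆_; _⊂_; _─_; _-_; ⁅_⁆; ∁; ∣_∣; Nonempty)
  renaming (⊥ to ∅; ⊤ to full)
open import Data.Fin.Subset.Properties
  using ( _∈?_; ⊆-antisym; drop-∷-⊆; out⊂in; out⊂; in⊂in; Empty-unique; ∉⊥; ∈⊤; ∣p∣≤n
        ; x∈⁅x⁆; x∈⁅y⁆⇒x≡y; x∈⁅y⁆⇔x≡y; x∈p∧x∉q⇒x∈p─q; p─q⊆p; x∈p∧x≢y⇒x∈p-y
        ; x∈p⇒∣p-x∣<∣p∣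
        ; x∉p⇒x∈∁p; x∈∁p⇒x∉p )
open import Data.List using ([]; _∷_)
open import Data.Maybe using (Maybe; nothing; just)
open import Data.Maybe.Properties using (just-injective)
open import Data.Nat using (ℕ; zero; suc; _<_; _≤_; _∸_; s≤s)
import Data.Nat.Properties as ℕ
open import Data.Product using (Σ; ∃; _×_; _,_; proj₁; proj₂)
open import Data.Sum using (_⊎_; inj₁; inj₂)
open import Data.Unit using (⊤; tt)
open import Data.Vec using ([]; _∷_; lookup; tabulate; here; there)
open import Data.Vec.Properties using (lookup∘tabulate; []=⇒lookup; lookup⇒[]=; ∷-injectiveˡ; ∷-injectiveʳ)
open import Function.Base using (_∘_; id)
open import Function.Bundles using (_⇔_; mk⇔; Equivalence)
open import Function.Definitions using (Injective)
open import Function.Properties.Bijection using (⤖⇒↔)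
open import Function.Properties.Inverse using (↔⇒⤖)
open import Function.Properties.Equivalence using ()
  renaming (refl to ⇔-refl; sym to ⇔-sym; trans to ⇔-trans)
open import Relation.Nullary using (¬_; Dec; yes; no)
open import Relation.Nullary.Decidable using (_×-dec_; _⊎-dec_; _→-dec_; ¬?)
open import Relation.Binary.PropositionalEquality
  using (_≡_; _≢_; refl; sym; trans; cong; cong₂; subst; subst₂; module ≡-Reasoning)

open import Defs

open Equivalence using (to; from)

private variable
  m n r : ℕ
  b c : Bool
  X Y : Set

-- Complete graphs K_r inside a type

-- ReconfIsoComplete A r unfolds to IsomorphicToK (IsMinimalDominating A) (ReconfAdj A) r.
IsomorphicToK : (X → Set) → (X → X → Set) → ℕ → Set
IsomorphicToK {X} P R r = Σ (Fin r → X) λ g →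
    (∀ i → P (g i))
  × Injective _≡_ _≡_ g
  × (∀ x → P x → ∃ λ i → g i ≡ x)
  × (∀ i j → R (g i) (g j) ⇔ (i ≢ j))

module _ {P : X → Set} {R : X → X → Set} where

  IsomorphicToK-adjacent : IsomorphicToK P R r → ∀ {x y} → P x → P y → x ≢ y → R x y
  IsomorphicToK-adjacent (_ , _ , _ , onto , adj) {x} {y} Px Py x≢y with onto x Px | onto y Py
  ... | i , refl | j , refl = from (adj i j) λ { refl → x≢y refl }

  IsomorphicToK-empty : ∀ {x} → P x → ¬ IsomorphicToK P R 0
  IsomorphicToK-empty {x} Px (_ , _ , _ , onto , _) with onto x Px
  ... | () , _

  IsomorphicToK-singleton : ∀ {x} → P x → (∀ y → P y → y ≡ x) → (∀ y → ¬ R y y) →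
                            IsomorphicToK P R r ⇔ r ≡ 1
  IsomorphicToK-singleton {x = x} Px unique irrefl = mk⇔ size single
    where
    size : IsomorphicToK P R r → r ≡ 1
    size {zero} K = ⊥-elim (IsomorphicToK-empty Px K)
    size {suc zero} _ = refl
    size {suc (suc _)} (g , Pg , g-inj , _ , _)
      with () ← g-inj {zero} {suc zero} (trans (unique _ (Pg zero)) (sym (unique _ (Pg (suc zero)))))
    single : r ≡ 1 → IsomorphicToK P R r
    single refl =
      (λ _ → x) , (λ _ → Px) , (λ { {zero} {zero} _ → refl }) , (λ y Py → zero , sym (unique y Py)) ,
      λ { zero zero → mk⇔ (λ Rxx → ⊥-elim (irrefl x Rxx)) (λ 0≢0 → ⊥-elim (0≢0 refl)) }

record InducedIso {X Y : Set} (P : X → Set) (R : X → X → Set) (Q : Y → Set) (R' : Y → Y → Set) : Set where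
  field
    map           : X → Y
    map-P         : ∀ {x} → P x → Q (map x)
    map-onto      : ∀ {y} → Q y → ∃ λ x → P x × map x ≡ y
    map-injective : Injective _≡_ _≡_ map
    map-R         : ∀ x x' → R' (map x) (map x') ⇔ R x x'

module _ {P : X → Set} {R : X → X → Set} {Q : Y → Set} {R' : Y → Y → Set} where

  IsomorphicToK-cong : InducedIso P R Q R' → IsomorphicToK P R r ⇔ IsomorphicToK Q R' r
  IsomorphicToK-cong φ = mk⇔ push pull
    where
    open InducedIso φ

    push : IsomorphicToK P R r → IsomorphicToK Q R' r
    push (g , Pg , g-inj , g-onto , g-adj) =
      map ∘ g , map-P ∘ Pg , g-inj ∘ map-injective , onto ,
      λ i j → ⇔-trans (map-R (g i) (g j)) (g-adj i j)
      where
      onto : ∀ y → Q y → ∃ λ i → map (g i) ≡ y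
      onto y Qy with map-onto Qy
      ... | x , Px , refl with g-onto x Px
      ...   | i , refl = i , refl

    pull : IsomorphicToK Q R' r → IsomorphicToK P R r
    pull {r} (g , Qg , g-inj , g-onto , g-adj) =
      g′ , (λ i → proj₁ (proj₂ (map-onto (Qg i)))) , g′-inj , onto ,
      λ i j → ⇔-trans (⇔-sym (map-R (g′ i) (g′ j)))
                      (subst₂ (λ y y' → R' y y' ⇔ (i ≢ j)) (sym (map-g′ i)) (sym (map-g′ j)) (g-adj i j))
      where
      g′ : Fin r → X
      g′ i = proj₁ (map-onto (Qg i))
      map-g′ : ∀ i → map (g′ i) ≡ g i
      map-g′ i = proj₂ (proj₂ (map-onto (Qg i)))
      g′-inj : Injective _≡_ _≡_ g′
      g′-inj {i} {j} e = g-inj (trans (sym (map-g′ i)) (trans (cong map e) (map-g′ j)))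
      onto : ∀ x → P x → ∃ λ i → g′ i ≡ x
      onto x Px with g-onto (map x) (map-P Px)
      ... | i , gi≡φx = i , map-injective (trans (map-g′ i) gi≡φx)

Cone : (X → Set) → Maybe X → Set
Cone P nothing  = ⊤
Cone P (just x) = P x

ConeAdj : (X → X → Set) → Maybe X → Maybe X → Set
ConeAdj R nothing  nothing  = Empty
ConeAdj R nothing  (just _) = ⊤
ConeAdj R (just _) nothing  = ⊤
ConeAdj R (just x) (just y) = R x y

≢⇔suc≢suc : {i j : Fin n} → (i ≢ j) ⇔ (suc i ≢ suc j)
≢⇔suc≢suc = mk⇔ (λ i≢j → i≢j ∘ suc-injective) (λ si≢sj → si≢sj ∘ cong suc)

module _ {P : X → Set} {R : X → X → Set} where

  IsomorphicToK-cone⁺ : IsomorphicToK P R r → IsomorphicToK (Cone P) (ConeAdj R) (suc r)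
  IsomorphicToK-cone⁺ {r} (g , Pg , g-inj , g-onto , g-adj) = g⁺ , Pg⁺ , g⁺-inj , onto , adj
    where
    g⁺ : Fin (suc r) → Maybe X
    g⁺ zero    = nothing
    g⁺ (suc i) = just (g i)
    Pg⁺ : ∀ i → Cone P (g⁺ i)
    Pg⁺ zero    = tt
    Pg⁺ (suc i) = Pg i
    g⁺-inj : Injective _≡_ _≡_ g⁺
    g⁺-inj {zero}  {zero}  _ = refl
    g⁺-inj {suc i} {suc j} e = cong suc (g-inj (just-injective e))
    onto : ∀ x → Cone P x → ∃ λ i → g⁺ i ≡ x
    onto nothing  _  = zero , refl
    onto (just x) Px with g-onto x Px
    ... | i , refl = suc i , refl
    adj : ∀ i j → ConeAdj R (g⁺ i) (g⁺ j) ⇔ (i ≢ j)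
    adj zero    zero    = mk⇔ (λ ()) (λ 0≢0 → ⊥-elim (0≢0 refl))
    adj zero    (suc j) = mk⇔ (λ _ ()) (λ _ → tt)
    adj (suc i) zero    = mk⇔ (λ _ ()) (λ _ → tt)
    adj (suc i) (suc j) = ⇔-trans (g-adj i j) ≢⇔suc≢suc

  -- The apex sits at some index i₀; the other vertices are enumerated by punchIn i₀.
  IsomorphicToK-cone⁻ : IsomorphicToK (Cone P) (ConeAdj R) (suc r) → IsomorphicToK P R r
  IsomorphicToK-cone⁻ {r} (g , Pg , g-inj , g-onto , g-adj) with g-onto nothing tt
  ... | i₀ , gi₀≡nothing = g⁻ , Pg⁻ , g⁻-inj , onto , adj
    where
    base : ∀ j → Σ X λ x → g (punchIn i₀ j) ≡ just x
    base j with g (punchIn i₀ j) in e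
    ... | just x  = x , refl
    ... | nothing = ⊥-elim (punchInᵢ≢i i₀ j (g-inj (trans e (sym gi₀≡nothing))))
    g⁻ : Fin r → X
    g⁻ j = proj₁ (base j)
    g-punchIn : ∀ j → g (punchIn i₀ j) ≡ just (g⁻ j)
    g-punchIn j = proj₂ (base j)
    Pg⁻ : ∀ j → P (g⁻ j)
    Pg⁻ j = subst (Cone P) (g-punchIn j) (Pg (punchIn i₀ j))
    g⁻-inj : Injective _≡_ _≡_ g⁻
    g⁻-inj {j} {k} e = punchIn-injective i₀ j k
      (g-inj (trans (g-punchIn j) (trans (cong just e) (sym (g-punchIn k)))))
    onto : ∀ x → P x → ∃ λ j → g⁻ j ≡ x
    onto x Px with g-onto (just x) Px
    ... | i , gi≡x with i₀ ≟ i
    ...   | yes refl with () ← trans (sym gi₀≡nothing) gi≡x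
    ...   | no i₀≢i = punchOut i₀≢i , just-injective (begin
      just (g⁻ (punchOut i₀≢i))        ≡⟨ sym (g-punchIn (punchOut i₀≢i)) ⟩
      g (punchIn i₀ (punchOut i₀≢i))   ≡⟨ cong g (punchIn-punchOut i₀≢i) ⟩
      g i                              ≡⟨ gi≡x ⟩
      just x                           ∎)
      where open ≡-Reasoning
    adj : ∀ j k → R (g⁻ j) (g⁻ k) ⇔ (j ≢ k)
    adj j k = ⇔-trans
      (subst₂ (λ y y' → ConeAdj R y y' ⇔ (punchIn i₀ j ≢ punchIn i₀ k))
              (g-punchIn j) (g-punchIn k) (g-adj (punchIn i₀ j) (punchIn i₀ k)))
      (mk⇔ (λ ne e → ne (cong (punchIn i₀) e)) (λ ne e → ne (punchIn-injective i₀ j k e)))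

x∈p─q⇒x∉q : ∀ {x : Fin n} {p q : Subset n} → x ∈ p ─ q → x ∉ q
x∈p─q⇒x∉q {p = _ ∷ p} {true  ∷ q} (there x∈) (there x∈q) = x∈p─q⇒x∉q {p = p} x∈ x∈q
x∈p─q⇒x∉q {p = _ ∷ p} {false ∷ q} (there x∈) (there x∈q) = x∈p─q⇒x∉q {p = p} x∈ x∈q

x∈p─q⇔x∈p×x∉q : ∀ {x : Fin n} {p q : Subset n} → x ∈ p ─ q ⇔ (x ∈ p × x ∉ q)
x∈p─q⇔x∈p×x∉q {p = p} {q} =
  mk⇔ (λ x∈ → p─q⊆p p q x∈ , x∈p─q⇒x∉q {p = p} x∈)
      (λ (x∈p , x∉q) → x∈p∧x∉q⇒x∈p─q x∈p x∉q)

⊆∧≢⇒⊂ : {p q : Subset n} → p ⊆ q → p ≢ q → p ⊂ q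
⊆∧≢⇒⊂ {p = []}        {[]}        _   p≢q = ⊥-elim (p≢q refl)
⊆∧≢⇒⊂ {p = true  ∷ p} {true  ∷ q} p⊆q p≢q = in⊂in (⊆∧≢⇒⊂ (drop-∷-⊆ p⊆q) (p≢q ∘ cong (true ∷_)))
⊆∧≢⇒⊂ {p = true  ∷ p} {false ∷ q} p⊆q _   with () ← p⊆q here
⊆∧≢⇒⊂ {p = false ∷ p} {true  ∷ q} p⊆q _   = out⊂in (drop-∷-⊆ p⊆q)
⊆∧≢⇒⊂ {p = false ∷ p} {false ∷ q} p⊆q p≢q = out⊂ (⊆∧≢⇒⊂ (drop-∷-⊆ p⊆q) (p≢q ∘ cong (false ∷_)))

∅─p≡∅ : (p : Subset n) → ∅ ─ p ≡ ∅
∅─p≡∅ p = Empty-unique λ (_ , x∈) → ∉⊥ (p─q⊆p ∅ p x∈)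

disjoint⇒≢ : {p q : Subset n} → Nonempty p → (∀ {x} → x ∈ q → x ∉ p) → p ≢ q
disjoint⇒≢ (x , x∈p) q∩p=∅ refl = q∩p=∅ x∈p x∈p

subset-ext : {p q : Subset n} → (∀ {x} → x ∈ p ⇔ x ∈ q) → p ≡ q
subset-ext p⇔q = ⊆-antisym (to p⇔q) (from p⇔q)

-- Domination

Dominates : Adjacency n → Subset n → Fin n → Set
Dominates A S v = v ∈ S ⊎ ∃ λ u → u ∈ S × A u v ≡ true

Is1MinimalDominating : Adjacency n → Subset n → Set
Is1MinimalDominating A S = IsDominating A S × (∀ v → v ∈ S → ¬ IsDominating A (S - v))

IsIsolated : Adjacency n → Fin n → Set
IsIsolated A v = ∀ w → A v w ≡ false

IsUniversal : Adjacency n → Fin n → Set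
IsUniversal A v = ∀ w → w ≢ v → A v w ≡ true

module _ {A : Adjacency n} where

  dominating-mono : {S T : Subset n} → T ⊆ S → IsDominating A T → IsDominating A S
  dominating-mono T⊆S dT v with dT v
  ... | inj₁ v∈T = inj₁ (T⊆S v∈T)
  ... | inj₂ (u , u∈T , uv) = inj₂ (u , T⊆S u∈T , uv)

  dominating? : (S : Subset n) → Dec (IsDominating A S)
  dominating? S = all? λ v → v ∈? S ⊎-dec any? λ u → u ∈? S ×-dec A u v Bool.≟ true

  minimal⇔1-minimal : {S : Subset n} → IsMinimalDominating A S ⇔ Is1MinimalDominating A S
  minimal⇔1-minimal {S} = mk⇔
    (λ (dS , minimal) → dS , λ v v∈S → minimal (S - v) (p─q⊆p S ⁅ v ⁆) (S-v≢S v∈S))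
    (λ (dS , irredundant) → dS , λ T T⊆S T≢S → ¬dominating-⊂ (⊆∧≢⇒⊂ T⊆S T≢S) irredundant)
    where
    S-v≢S : ∀ {v} → v ∈ S → S - v ≢ S
    S-v≢S {v} v∈S e = x∈p─q⇒x∉q {p = S} (subst (v ∈_) (sym e) v∈S) (x∈⁅x⁆ v)
    ¬dominating-⊂ : ∀ {T} → T ⊂ S → (∀ v → v ∈ S → ¬ IsDominating A (S - v)) → ¬ IsDominating A T
    ¬dominating-⊂ (T⊆S , v , v∈S , v∉T) irredundant dT =
      irredundant v v∈S (dominating-mono (λ x∈T → x∈p∧x≢y⇒x∈p-y (T⊆S x∈T) λ { refl → v∉T x∈T }) dT)

  1-minimal-dominating-⊆ : {S : Subset n} → IsDominating A S → ∃ λ M → M ⊆ S × Is1MinimalDominating A M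
  1-minimal-dominating-⊆ {S} = shrink (suc n) S (s≤s (∣p∣≤n S))
    where
    shrink : ∀ k S → ∣ S ∣ < k → IsDominating A S → ∃ λ M → M ⊆ S × Is1MinimalDominating A M
    shrink (suc k) S (s≤s ∣S∣≤k) dS with any? (λ v → v ∈? S ×-dec dominating? (S - v))
    ... | no irredundant = S , id , dS , λ v v∈S dS-v → irredundant (v , v∈S , dS-v)
    ... | yes (v , v∈S , dS-v) with shrink k (S - v) (ℕ.<-≤-trans (x∈p⇒∣p-x∣<∣p∣ v∈S) ∣S∣≤k) dS-v
    ...   | M , M⊆S-v , minimal = M , p─q⊆p S ⁅ v ⁆ ∘ M⊆S-v , minimal

  1-minimal-dominating : ∃ (Is1MinimalDominating A)
  1-minimal-dominating with 1-minimal-dominating-⊆ {full} (λ _ → inj₁ ∈⊤)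
  ... | M , _ , minimal = M , minimal

  dominating-⊆⁅⁆⇒universal : ∀ {S v} → IsDominating A S → S ⊆ ⁅ v ⁆ → IsUniversal A v
  dominating-⊆⁅⁆⇒universal {v = v} dS S⊆v w w≢v with dS w
  ... | inj₁ w∈S = ⊥-elim (w≢v (x∈⁅y⁆⇒x≡y v (S⊆v w∈S)))
  ... | inj₂ (u , u∈S , uw) = subst (λ u → A u w ≡ true) (x∈⁅y⁆⇒x≡y v (S⊆v u∈S)) uw

dominating-nonempty : {A : Adjacency (suc n)} {S : Subset (suc n)} → IsDominating A S → Nonempty S
dominating-nonempty dS with dS zero
... | inj₁ 0∈S = zero , 0∈S
... | inj₂ (u , u∈S , _) = u , u∈S

module _ {A : Adjacency n} (simple : IsSimpleGraph A) where

  adjacent⇒≢ : ∀ {u v} → A u v ≡ true → u ≢ v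
  adjacent⇒≢ {u} uv refl with () ← trans (sym uv) (proj₂ simple u)

  dominating-remove : ∀ {D w} → ∃ (λ x → A w x ≡ true) → (∀ x → A w x ≡ true → x ∈ D) →
                      IsDominating A D → IsDominating A (D - w)
  dominating-remove {D} {w} (x , wx) N⊆D dD y with y ≟ w
  ... | yes refl =
    inj₂ (x , x∈p∧x≢y⇒x∈p-y (N⊆D x wx) (adjacent⇒≢ wx ∘ sym) , trans (proj₁ simple x w) wx)
  ... | no y≢w with dD y
  ...   | inj₁ y∈D = inj₁ (x∈p∧x≢y⇒x∈p-y y∈D y≢w)
  ...   | inj₂ (u , u∈D , uy) with u ≟ w
  ...     | no u≢w = inj₂ (u , x∈p∧x≢y⇒x∈p-y u∈D u≢w , uy)
  ...     | yes refl = inj₁ (x∈p∧x≢y⇒x∈p-y (N⊆D y uy) y≢w)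

  ∁-dominating : (∀ v → ∃ λ w → A v w ≡ true) →
                 ∀ {D} → Is1MinimalDominating A D → IsDominating A (∁ D)
  ∁-dominating neighbour {D} (dD , irredundant) w with w ∈? D
  ... | no w∉D = inj₁ (x∉p⇒x∈∁p w∉D)
  ... | yes w∈D with any? (λ x → x ∈? ∁ D ×-dec A x w Bool.≟ true)
  ...   | yes outside-neighbour = inj₂ outside-neighbour
  ...   | no none = ⊥-elim (irredundant w w∈D (dominating-remove (neighbour w) N⊆D dD))
    where
    N⊆D : ∀ x → A w x ≡ true → x ∈ D
    N⊆D x wx with x ∈? D
    ... | yes x∈D = x∈D
    ... | no x∉D = ⊥-elim (none (x , x∉p⇒x∈∁p x∉D , trans (proj₁ simple x w) wx))

-- Reconfiguration adjacency

-- ReconfAdj A M₁ M₂ unfolds to ∃ λ v → Exchange A M₁ M₂ v ⊎ Exchange A M₂ M₁ v.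
Exchange : Adjacency n → Subset n → Subset n → Fin n → Set
Exchange A P Q v = Q ─ P ≡ ⁅ v ⁆ × (∀ u → u ∈ P ─ Q → A u v ≡ true)

ReconfK : Adjacency n → ℕ → Set
ReconfK A = IsomorphicToK (Is1MinimalDominating A) (ReconfAdj A)

ReconfAdj-map : {A : Adjacency m} {B : Adjacency n} (φ : Subset m → Subset n) (f : Fin m → Fin n) →
                (∀ {P Q v} → Exchange A P Q v → Exchange B (φ P) (φ Q) (f v)) →
                ∀ {M₁ M₂} → ReconfAdj A M₁ M₂ → ReconfAdj B (φ M₁) (φ M₂)
ReconfAdj-map φ f exchange (v , inj₁ e) = f v , inj₁ (exchange e)
ReconfAdj-map φ f exchange (v , inj₂ e) = f v , inj₂ (exchange e)

module _ {A : Adjacency n} where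

  ¬Exchange-refl : ∀ {P v} → ¬ Exchange A P P v
  ¬Exchange-refl {P} {v} (P─P≡v , _) with v∈P─P ← subst (v ∈_) (sym P─P≡v) (x∈⁅x⁆ v)
    = x∈p─q⇒x∉q {p = P} v∈P─P (p─q⊆p P P v∈P─P)

  ReconfAdj-irrefl : ∀ M → ¬ ReconfAdj A M M
  ReconfAdj-irrefl M (_ , inj₁ e) = ¬Exchange-refl e
  ReconfAdj-irrefl M (_ , inj₂ e) = ¬Exchange-refl e

  ReconfAdj-sym : ∀ {M₁ M₂} → ReconfAdj A M₁ M₂ → ReconfAdj A M₂ M₁
  ReconfAdj-sym (v , inj₁ e) = v , inj₂ e
  ReconfAdj-sym (v , inj₂ e) = v , inj₁ e

  Exchange-disjoint : ∀ {P Q v} → (∀ {u} → u ∈ Q → u ∉ P) → Exchange A P Q v → Q ⊆ ⁅ v ⁆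
  Exchange-disjoint disjoint (Q─P≡v , _) u∈Q =
    subst (_ ∈_) Q─P≡v (x∈p∧x∉q⇒x∈p─q u∈Q (disjoint u∈Q))

  disjoint-ReconfAdj⇒universal : ∀ {D M} → Is1MinimalDominating A D → Is1MinimalDominating A M →
                                 (∀ {u} → u ∈ M → u ∉ D) → ReconfAdj A D M → ∃ (IsUniversal A)
  disjoint-ReconfAdj⇒universal _ (dM , _) disjoint (v , inj₁ e) =
    v , dominating-⊆⁅⁆⇒universal dM (Exchange-disjoint disjoint e)
  disjoint-ReconfAdj⇒universal (dD , _) _ disjoint (v , inj₂ e) =
    v , dominating-⊆⁅⁆⇒universal dD (Exchange-disjoint (λ u∈D u∈M → disjoint u∈M u∈D) e)

¬ReconfK-without-isolated-or-universal :
  {A : Adjacency (suc n)} → IsSimpleGraph A →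
  (∀ v → ∃ λ w → A v w ≡ true) → (∀ v → ¬ IsUniversal A v) →
  ¬ ReconfK A r
¬ReconfK-without-isolated-or-universal {A = A} simple neighbour non-universal K
  with D , minD ← 1-minimal-dominating {A = A}
  with M , M⊆∁D , minM ← 1-minimal-dominating-⊆ (∁-dominating simple neighbour minD)
  with v , universal ← disjoint-ReconfAdj⇒universal minD minM (x∈∁p⇒x∉p ∘ M⊆∁D)
    (IsomorphicToK-adjacent K minD minM
      (disjoint⇒≢ (dominating-nonempty (proj₁ minD)) (x∈∁p⇒x∉p ∘ M⊆∁D)))
  = non-universal v universal

-- Adding an isolated or a universal vertex

module _ {A : Adjacency n} where

  dominates-suc⁺ : ∀ {S v} → Dominates A S v → Dominates (extend b A) (c ∷ S) (suc v)
  dominates-suc⁺ (inj₁ v∈S) = inj₁ (there v∈S)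
  dominates-suc⁺ (inj₂ (u , u∈S , uv)) = inj₂ (suc u , there u∈S , uv)

  dominates-suc⁻ : ∀ {S v} → Dominates (extend b A) (c ∷ S) (suc v) →
                   Dominates A S v ⊎ (b ≡ true × c ≡ true)
  dominates-suc⁻ (inj₁ (there v∈S)) = inj₁ (inj₁ v∈S)
  dominates-suc⁻ (inj₂ (zero , here , b≡true)) = inj₂ (b≡true , refl)
  dominates-suc⁻ (inj₂ (suc u , there u∈S , uv)) = inj₁ (inj₂ (u , u∈S , uv))

  isolated-dominated : ∀ {T} → Dominates (extend false A) T zero → zero ∈ T
  isolated-dominated (inj₁ 0∈T) = 0∈T
  isolated-dominated (inj₂ (suc _ , _ , ()))

  dominating-extend-isolated : ∀ {S} → IsDominating (extend false A) (true ∷ S) ⇔ IsDominating A S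
  dominating-extend-isolated = mk⇔
    (λ d v → restrict (dominates-suc⁻ (d (suc v))))
    (λ { d zero → inj₁ here ; d (suc v) → dominates-suc⁺ (d v) })
    where
    restrict : ∀ {S v} → Dominates A S v ⊎ (false ≡ true × true ≡ true) → Dominates A S v
    restrict (inj₁ dv) = dv

  apex-dominating : ∀ {S} → IsDominating (extend true A) (true ∷ S)
  apex-dominating zero    = inj₁ here
  apex-dominating (suc v) = inj₂ (zero , here , refl)

  1-minimal-extend : (∀ {T} → IsDominating (extend b A) (c ∷ T) ⇔ IsDominating A T) →
                     ∀ {S} → (zero ∈ c ∷ S → ¬ IsDominating (extend b A) ((c ∷ S) - zero)) →
                     Is1MinimalDominating (extend b A) (c ∷ S) ⇔ Is1MinimalDominating A S
  1-minimal-extend dom zero-needed = mk⇔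
    (λ (d , irredundant) → to dom d , λ v v∈S d-v → irredundant (suc v) (there v∈S) (from dom d-v))
    (λ (d , irredundant) → from dom d ,
       λ { zero 0∈ d-0 → zero-needed 0∈ d-0 ; (suc v) (there v∈S) d-v → irredundant v v∈S (to dom d-v) })

  1-minimal-extend-isolated : ∀ {S} → Is1MinimalDominating (extend false A) (true ∷ S) ⇔ Is1MinimalDominating A S
  1-minimal-extend-isolated = 1-minimal-extend dominating-extend-isolated
    λ _ d → zero∉false∷ (isolated-dominated (d zero))
    where
    zero∉false∷ : ∀ {T : Subset n} → zero ∉ false ∷ T
    zero∉false∷ ()

  1-minimal-apex : ∀ {S} → Is1MinimalDominating (extend true A) (true ∷ S) ⇔ S ≡ ∅
  1-minimal-apex = mk⇔
    (λ (_ , irredundant) → Empty-unique λ (u , u∈S) → irredundant (suc u) (there u∈S) apex-dominating)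
    (λ { refl → apex-dominating , λ { zero _ d → no-vertex (dominating-nonempty d)
                                    ; (suc v) (there v∈∅) → ⊥-elim (∉⊥ v∈∅) } })
    where
    no-vertex : ¬ Nonempty (false ∷ (∅ {n} ─ ∅))
    no-vertex (suc u , there u∈) = ∉⊥ (p─q⊆p ∅ ∅ u∈)

  -- Not refl for a variable c: the head of _─_ only computes once c is known.
  cons─cons : ∀ c (P Q : Subset n) → (c ∷ P) ─ (c ∷ Q) ≡ false ∷ (P ─ Q)
  cons─cons true  _ _ = refl
  cons─cons false _ _ = refl

  ¬Exchange-cons-zero : ∀ {P Q} → ¬ Exchange (extend b A) (c ∷ P) (c ∷ Q) zero
  ¬Exchange-cons-zero {c = c} {P} {Q} (e , _) with () ← ∷-injectiveˡ (trans (sym (cons─cons c Q P)) e)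

  Exchange-cons : ∀ {P Q v} → Exchange (extend b A) (c ∷ P) (c ∷ Q) (suc v) ⇔ Exchange A P Q v
  Exchange-cons {b} {c} {P} {Q} {v} = mk⇔
    (λ (e , nbr) → ∷-injectiveʳ e , λ u u∈ → nbr (suc u) (there u∈))
    (λ (e , nbr) → trans (cons─cons c Q P) (cong (false ∷_) e) ,
                   λ u u∈ → lift-nbr nbr u (subst (u ∈_) (cons─cons c P Q) u∈))
    where
    lift-nbr : (∀ u → u ∈ P ─ Q → A u v ≡ true) →
               ∀ u → u ∈ false ∷ (P ─ Q) → extend b A u (suc v) ≡ true
    lift-nbr nbr (suc u) (there u∈) = nbr u u∈

  ReconfAdj-cons : ∀ {S₁ S₂} → ReconfAdj (extend b A) (c ∷ S₁) (c ∷ S₂) ⇔ ReconfAdj A S₁ S₂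
  ReconfAdj-cons {b} {c} = mk⇔ restrict (ReconfAdj-map (c ∷_) suc (from (Exchange-cons {b} {c})))
    where
    restrict : ∀ {S₁ S₂} → ReconfAdj (extend b A) (c ∷ S₁) (c ∷ S₂) → ReconfAdj A S₁ S₂
    restrict (zero  , inj₁ e) = ⊥-elim (¬Exchange-cons-zero {b = b} {c} e)
    restrict (zero  , inj₂ e) = ⊥-elim (¬Exchange-cons-zero {b = b} {c} e)
    restrict (suc v , inj₁ e) = v , inj₁ (to (Exchange-cons {b} {c}) e)
    restrict (suc v , inj₂ e) = v , inj₂ (to (Exchange-cons {b} {c}) e)

  apex-adjacent : ∀ {S} → ReconfAdj (extend true A) (true ∷ ∅) (false ∷ S)
  apex-adjacent {S} = zero , inj₂ (cong (true ∷_) (∅─p≡∅ S) , λ { (suc u) _ → refl })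

module _ {A : Adjacency (suc n)} where

  dominating-extend-universal : ∀ {S} → IsDominating (extend true A) (false ∷ S) ⇔ IsDominating A S
  dominating-extend-universal = mk⇔
    (λ d v → restrict (dominates-suc⁻ (d (suc v))))
    (λ d → λ { zero → apex-dominated (dominating-nonempty d) ; (suc v) → dominates-suc⁺ (d v) })
    where
    restrict : ∀ {S v} → Dominates A S v ⊎ (true ≡ true × false ≡ true) → Dominates A S v
    restrict (inj₁ dv) = dv
    apex-dominated : ∀ {S} → Nonempty S → Dominates (extend true A) (false ∷ S) zero
    apex-dominated (u , u∈S) = inj₂ (suc u , there u∈S , refl)

  1-minimal-extend-universal : ∀ {S} → Is1MinimalDominating (extend true A) (false ∷ S) ⇔ Is1MinimalDominating A S
  1-minimal-extend-universal = 1-minimal-extend dominating-extend-universal λ ()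

isolated-InducedIso : (A : Adjacency n) →
  InducedIso (Is1MinimalDominating A) (ReconfAdj A)
             (Is1MinimalDominating (extend false A)) (ReconfAdj (extend false A))
isolated-InducedIso A = record
  { map           = true ∷_
  ; map-P         = from 1-minimal-extend-isolated
  ; map-onto      = onto
  ; map-injective = ∷-injectiveʳ
  ; map-R         = λ _ _ → ReconfAdj-cons {b = false} {true}
  }
  where
  onto : ∀ {T} → Is1MinimalDominating (extend false A) T → ∃ λ S → Is1MinimalDominating A S × true ∷ S ≡ T
  onto {c ∷ T} minimal with here ← isolated-dominated {A = A} (proj₁ minimal zero)
    = T , to 1-minimal-extend-isolated minimal , refl

universal-InducedIso : (A : Adjacency (suc n)) →
  InducedIso (Cone (Is1MinimalDominating A)) (ConeAdj (ReconfAdj A))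
             (Is1MinimalDominating (extend true A)) (ReconfAdj (extend true A))
universal-InducedIso A = record
  { map           = cone-set
  ; map-P         = P
  ; map-onto      = onto
  ; map-injective = injective
  ; map-R         = adj
  }
  where
  cone-set : Maybe (Subset (suc n)) → Subset (suc (suc n))
  cone-set nothing  = true ∷ ∅
  cone-set (just S) = false ∷ S
  P : ∀ {S} → Cone (Is1MinimalDominating A) S → Is1MinimalDominating (extend true A) (cone-set S)
  P {nothing} _       = from 1-minimal-apex refl
  P {just S}  minimal = from 1-minimal-extend-universal minimal
  onto : ∀ {T} → Is1MinimalDominating (extend true A) T →
         ∃ λ S → Cone (Is1MinimalDominating A) S × cone-set S ≡ T
  onto {true  ∷ T} minimal = nothing , tt , cong (true ∷_) (sym (to 1-minimal-apex minimal))
  onto {false ∷ T} minimal = just T , to 1-minimal-extend-universal minimal , refl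
  injective : Injective _≡_ _≡_ cone-set
  injective {nothing} {nothing} _ = refl
  injective {just _}  {just _}  e = cong just (∷-injectiveʳ e)
  adj : ∀ S S' → ReconfAdj (extend true A) (cone-set S) (cone-set S') ⇔ ConeAdj (ReconfAdj A) S S'
  adj nothing  nothing  = mk⇔ (ReconfAdj-irrefl (true ∷ ∅)) ⊥-elim
  adj nothing  (just S) = mk⇔ (λ _ → tt) (λ _ → apex-adjacent {A = A} {S})
  adj (just S) nothing  = mk⇔ (λ _ → tt) (λ _ → ReconfAdj-sym {M₁ = true ∷ ∅} (apex-adjacent {A = A} {S}))
  adj (just _) (just _) = ReconfAdj-cons {b = true} {false}

-- Relabelling vertices

record _≅_ (A : Adjacency m) (B : Adjacency n) : Set where
  constructor mk≅
  field
    perm     : Permutation m n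
    preserve : ∀ i j → B (perm ⟨$⟩ʳ i) (perm ⟨$⟩ʳ j) ≡ A i j

GraphIso⇔≅ : {A : Adjacency m} {B : Adjacency n} → GraphIso A B ⇔ A ≅ B
GraphIso⇔≅ = mk⇔ (λ (f , adj) → mk≅ (⤖⇒↔ f) adj) (λ (mk≅ π adj) → ↔⇒⤖ π , adj)

module _ {A : Adjacency m} {B : Adjacency n} where

  ≅-sym : A ≅ B → B ≅ A
  ≅-sym (mk≅ π adj) = mk≅ (flip π) λ i j →
    trans (sym (adj (π ⟨$⟩ˡ i) (π ⟨$⟩ˡ j))) (cong₂ B (inverseʳ π) (inverseʳ π))

  extend-≅ : A ≅ B → extend b A ≅ extend b B
  extend-≅ (mk≅ π adj) = mk≅ (lift₀ π) λ
    { zero zero → refl ; zero (suc j) → refl ; (suc i) zero → refl ; (suc i) (suc j) → adj i j }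

≅-trans : {k : ℕ} {A : Adjacency k} {B : Adjacency m} {C : Adjacency n} → A ≅ B → B ≅ C → A ≅ C
≅-trans (mk≅ π adj) (mk≅ ρ adj') = mk≅ (π ∘ₚ ρ) λ i j → trans (adj' _ _) (adj i j)

one-vertex-≅ : {A B : Adjacency 1} → A zero zero ≡ false → B zero zero ≡ false → A ≅ B
one-vertex-≅ A00 B00 = mk≅ idₚ λ { zero zero → trans B00 (sym A00) }

image : Permutation m n → Subset m → Subset n
image π S = tabulate λ w → lookup S (π ⟨$⟩ˡ w)

module _ (π : Permutation m n) where

  ∈-image : ∀ {S w} → w ∈ image π S ⇔ π ⟨$⟩ˡ w ∈ S
  ∈-image {S} {w} = mk⇔
    (λ w∈ → lookup⇒[]= _ S (trans (sym (lookup∘tabulate _ w)) ([]=⇒lookup w∈)))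
    (λ x∈ → lookup⇒[]= w _ (trans (lookup∘tabulate _ w) ([]=⇒lookup x∈)))

  ∈-image⁺ : ∀ {S v} → v ∈ S → π ⟨$⟩ʳ v ∈ image π S
  ∈-image⁺ {S} v∈S = from ∈-image (subst (_∈ S) (sym (inverseˡ π)) v∈S)

  image-─ : ∀ {P Q} → image π (P ─ Q) ≡ image π P ─ image π Q
  image-─ {P} {Q} = subset-ext λ {x} →
    ⇔-trans (∈-image {P ─ Q}) (⇔-trans (x∈p─q⇔x∈p×x∉q {p = P} {Q}) (⇔-trans
      (mk⇔ (λ (x∈P , x∉Q) → from ∈-image x∈P , x∉Q ∘ to ∈-image)
           (λ (x∈P , x∉Q) → to ∈-image x∈P , x∉Q ∘ from ∈-image))
      (⇔-sym (x∈p─q⇔x∈p×x∉q {p = image π P} {image π Q}))))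

  image-⁅⁆ : ∀ {v} → image π ⁅ v ⁆ ≡ ⁅ π ⟨$⟩ʳ v ⁆
  image-⁅⁆ {v} = subset-ext (⇔-trans ∈-image (⇔-trans x∈⁅y⁆⇔x≡y (⇔-trans
    (mk⇔ (λ { refl → sym (inverseʳ π) }) (λ { refl → inverseˡ π }))
    (⇔-sym x∈⁅y⁆⇔x≡y))))

image-flip : (π : Permutation m n) → ∀ {S} → image (flip π) (image π S) ≡ S
image-flip π {S} = subset-ext (⇔-trans (∈-image (flip π)) (⇔-trans (∈-image π)
  (mk⇔ (subst (_∈ S) (inverseˡ π)) (subst (_∈ S) (sym (inverseˡ π))))))

module _ {A : Adjacency m} {B : Adjacency n} (iso : A ≅ B) where

  open _≅_ iso renaming (perm to π; preserve to adj)

  dominating-image : ∀ {S} → IsDominating A S → IsDominating B (image π S)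
  dominating-image dS w with dS (π ⟨$⟩ˡ w)
  ... | inj₁ x∈S = inj₁ (from (∈-image π) x∈S)
  ... | inj₂ (u , u∈S , uw) = inj₂ (π ⟨$⟩ʳ u , ∈-image⁺ π u∈S ,
    trans (cong (B (π ⟨$⟩ʳ u)) (sym (inverseʳ π))) (trans (adj u (π ⟨$⟩ˡ w)) uw))

  Exchange-image : ∀ {P Q v} → Exchange A P Q v → Exchange B (image π P) (image π Q) (π ⟨$⟩ʳ v)
  Exchange-image {P} {Q} {v} (Q─P≡v , nbr) =
    trans (sym (image-─ π {Q} {P})) (trans (cong (image π) Q─P≡v) (image-⁅⁆ π)) ,
    λ u u∈ → trans (cong (λ x → B x (π ⟨$⟩ʳ v)) (sym (inverseʳ π)))
                   (trans (adj _ v) (nbr _ (to (∈-image π) (subst (u ∈_) (sym (image-─ π {P} {Q})) u∈))))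

module _ {A : Adjacency m} {B : Adjacency n} (iso : A ≅ B) where

  open _≅_ iso renaming (perm to π)

  1-minimal-image : ∀ {S} → Is1MinimalDominating A S → Is1MinimalDominating B (image π S)
  1-minimal-image {S} (dS , irredundant) = dominating-image iso dS , λ w w∈ d →
    irredundant (π ⟨$⟩ˡ w) (to (∈-image π) w∈)
                (subst (IsDominating A) image-of-removal (dominating-image (≅-sym iso) d))
    where
    open ≡-Reasoning
    image-of-removal : ∀ {w} → image (flip π) (image π S - w) ≡ S - (π ⟨$⟩ˡ w)
    image-of-removal {w} = begin
      image (flip π) (image π S ─ ⁅ w ⁆)                   ≡⟨ image-─ (flip π) {image π S} {⁅ w ⁆} ⟩
      image (flip π) (image π S) ─ image (flip π) ⁅ w ⁆   ≡⟨ cong₂ _─_ (image-flip π) (image-⁅⁆ (flip π)) ⟩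
      S ─ ⁅ π ⟨$⟩ˡ w ⁆                                     ∎

  ReconfAdj-image : ∀ {M₁ M₂} → ReconfAdj B (image π M₁) (image π M₂) ⇔ ReconfAdj A M₁ M₂
  ReconfAdj-image = mk⇔
    (subst₂ (ReconfAdj A) (image-flip π) (image-flip π)
      ∘ ReconfAdj-map (image (flip π)) (flip π ⟨$⟩ʳ_) (Exchange-image (≅-sym iso)))
    (ReconfAdj-map (image π) (π ⟨$⟩ʳ_) (Exchange-image iso))

image-InducedIso : {A : Adjacency m} {B : Adjacency n} (iso : A ≅ B) →
  InducedIso (Is1MinimalDominating A) (ReconfAdj A) (Is1MinimalDominating B) (ReconfAdj B)
image-InducedIso iso@(mk≅ π _) = record
  { map           = image π
  ; map-P         = 1-minimal-image iso
  ; map-onto      = λ {T} minimal → image (flip π) T , 1-minimal-image (≅-sym iso) minimal , image-flip (flip π)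
  ; map-injective = λ e → trans (sym (image-flip π)) (trans (cong (image (flip π)) e) (image-flip π))
  ; map-R         = λ _ _ → ReconfAdj-image iso
  }

ReconfIsoComplete⇔ReconfK : {A : Adjacency n} → ReconfIsoComplete A r ⇔ ReconfK A r
ReconfIsoComplete⇔ReconfK {A = A} =
  IsomorphicToK-cong {P = IsMinimalDominating A} {ReconfAdj A} {Is1MinimalDominating A} {ReconfAdj A} record
  { map           = id
  ; map-P         = to minimal⇔1-minimal
  ; map-onto      = λ minimal → _ , from minimal⇔1-minimal minimal , refl
  ; map-injective = id
  ; map-R         = λ _ _ → ⇔-refl
  }

ReconfK-≅ : {A : Adjacency m} {B : Adjacency n} → A ≅ B → ReconfK A r ⇔ ReconfK B r
ReconfK-≅ iso = IsomorphicToK-cong (image-InducedIso iso)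

¬ReconfK-zero : {A : Adjacency n} → ¬ ReconfK A 0
¬ReconfK-zero {A = A} = IsomorphicToK-empty {R = ReconfAdj A} (proj₂ 1-minimal-dominating)

ReconfK-one-vertex : {A : Adjacency 1} → A zero zero ≡ false → ReconfK A r ⇔ r ≡ 1
ReconfK-one-vertex A00 =
  ⇔-trans (⇔-sym (ReconfK-≅ (one-vertex-≅ refl A00)))
  (⇔-trans (⇔-sym (IsomorphicToK-cong (isolated-InducedIso no-edges)))
           (IsomorphicToK-singleton {P = Is1MinimalDominating no-edges} {ReconfAdj no-edges} {x = []}
              ((λ ()) , λ ()) (λ { [] _ → refl }) (ReconfAdj-irrefl {A = no-edges})))
  where
  no-edges : Adjacency 0
  no-edges ()

ReconfK-build : ∀ cs → ReconfK (build cs) (suc (countUniversal cs))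
ReconfK-build []           = from (ReconfK-one-vertex refl) refl
ReconfK-build (false ∷ cs) = to (IsomorphicToK-cong (isolated-InducedIso (build cs))) (ReconfK-build cs)
ReconfK-build (true ∷ cs)  = to (IsomorphicToK-cong (universal-InducedIso (build cs)))
                                (IsomorphicToK-cone⁺ (ReconfK-build cs))

remove : Fin (suc n) → Adjacency (suc n) → Adjacency n
remove v A i j = A (punchIn v i) (punchIn v j)

remove-simple : {A : Adjacency (suc n)} (v : Fin (suc n)) → IsSimpleGraph A → IsSimpleGraph (remove v A)
remove-simple v (symmetric , irreflexive) = (λ i j → symmetric _ _) , (λ i → irreflexive _)

extend-remove-≅ : {A : Adjacency (suc n)} {v : Fin (suc n)} → IsSimpleGraph A →
                  (∀ w → w ≢ v → A v w ≡ b) → extend b (remove v A) ≅ A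
extend-remove-≅ {b = b} {A = A} {v} (symmetric , irreflexive) Avw≡b = mk≅ π adj
  where
  π : Permutation (suc _) (suc _)
  π = insert zero v idₚ
  adj : ∀ i j → A (π ⟨$⟩ʳ i) (π ⟨$⟩ʳ j) ≡ extend b (remove v A) i j
  adj zero zero = irreflexive v
  adj zero (suc j) rewrite insert-punchIn zero v idₚ j = Avw≡b _ (punchInᵢ≢i v j)
  adj (suc i) zero rewrite insert-punchIn zero v idₚ i = trans (symmetric _ v) (Avw≡b _ (punchInᵢ≢i v i))
  adj (suc i) (suc j) rewrite insert-punchIn zero v idₚ i | insert-punchIn zero v idₚ j = refl

ReconfK-remove-isolated : {A : Adjacency (suc n)} {v : Fin (suc n)} → IsSimpleGraph A →
                          IsIsolated A v → ReconfK A r → ReconfK (remove v A) r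
ReconfK-remove-isolated simple isolated =
    from (IsomorphicToK-cong (isolated-InducedIso _))
  ∘ from (ReconfK-≅ (extend-remove-≅ simple λ w _ → isolated w))

ReconfK-remove-universal : {A : Adjacency (suc (suc n))} {v : Fin (suc (suc n))} → IsSimpleGraph A →
                           IsUniversal A v → ReconfK A (suc r) → ReconfK (remove v A) r
ReconfK-remove-universal simple universal =
    IsomorphicToK-cone⁻
  ∘ from (IsomorphicToK-cong (universal-InducedIso _))
  ∘ from (ReconfK-≅ (extend-remove-≅ simple universal))

isolated? : (A : Adjacency n) → ∀ v → Dec (IsIsolated A v)
isolated? A v = all? λ w → A v w Bool.≟ false

universal? : (A : Adjacency n) → ∀ v → Dec (IsUniversal A v)
universal? A v = all? λ w → ¬? (w ≟ v) →-dec A v w Bool.≟ true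

¬isolated⇒neighbour : {A : Adjacency n} {v : Fin n} → ¬ IsIsolated A v → ∃ λ w → A v w ≡ true
¬isolated⇒neighbour {A = A} {v} ¬isolated
  with w , Avw≢false ← ¬∀⟶∃¬ _ _ (λ w → A v w Bool.≟ false) ¬isolated
  = w , Bool.¬-not Avw≢false

threshold-construction : ∀ m (A : Adjacency (suc m)) → IsSimpleGraph A → ReconfK A r →
                         ∃ λ cs → suc (countUniversal cs) ≡ r × build cs ≅ A
threshold-construction {zero} _ _ _ K = ⊥-elim (¬ReconfK-zero K)
threshold-construction {suc _} zero A simple K =
  [] , sym (to (ReconfK-one-vertex (proj₂ simple zero)) K) , one-vertex-≅ refl (proj₂ simple zero)
threshold-construction {suc _} (suc m) A simple K with any? (isolated? A) | any? (universal? A)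
... | yes (v , isolated) | _ =
  let cs , r≡ , J = threshold-construction m (remove v A) (remove-simple v simple)
                                           (ReconfK-remove-isolated {A = A} {v} simple isolated K)
  in false ∷ cs , r≡ , ≅-trans (extend-≅ J) (extend-remove-≅ simple λ w _ → isolated w)
... | no _ | yes (v , universal) =
  let cs , r≡ , J = threshold-construction m (remove v A) (remove-simple v simple)
                                           (ReconfK-remove-universal {A = A} {v} simple universal K)
  in true ∷ cs , cong suc r≡ , ≅-trans (extend-≅ J) (extend-remove-≅ simple universal)
... | no ¬isolated | no ¬universal = ⊥-elim (¬ReconfK-without-isolated-or-universal simple
  (λ v → ¬isolated⇒neighbour {A = A} λ isolated → ¬isolated (v , isolated))
  (λ v universal → ¬universal (v , universal)) K)

theorem8 : (n : ℕ) → 1 ≤ n → (A : Adjacency n) → IsSimpleGraph A →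
    (r : ℕ) → 1 ≤ r →
    ReconfIsoComplete A r ⇔ IsThresholdWithUniversal A (r ∸ 1)
theorem8 zero    ()
theorem8 (suc m) _ A simple zero ()
theorem8 (suc m) _ A simple (suc k) _ = mk⇔
  (λ K → let cs , count≡ , iso = threshold-construction m A simple (to ReconfIsoComplete⇔ReconfK K)
         in cs , ℕ.suc-injective count≡ , from GraphIso⇔≅ iso)
  (λ (cs , count≡k , iso) → from ReconfIsoComplete⇔ReconfK
    (subst (ReconfK A ∘ suc) count≡k (to (ReconfK-≅ (to GraphIso⇔≅ iso)) (ReconfK-build cs))))
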